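{- Let $G$ and $H$ be graphs. If $G\cong_f H$, then $G\equiv H$.
   Context: All graphs are finite, simple (no loops or multiple edges). For a graph $G$ with vertices $v_1,\dots,v_n$, its adjacency matrix $A_G\in\{0,1\}^{n\times n}$ has $A_G(i,j)=1$ iff $v_iv_j\in E(G)$. A doubly stochastic matrix is a square matrix with nonnegative entries whose rows and columns each sum to $1$. Graphs $G$ and $H$ are fractionally isomorphic, written $G\cong_f H$, if there is a doubly stochastic matrix $S$ with $A_G S=S A_H$. A hypergraph $G=(V,X)$ consists of a finite vertex set $V$ and a family $X$ of subsets of $V$ (hyperedges); graphs are the $2$-uniform hypergraphs. If $G$ has $n$ vertices and $m\ge 1$ hyperedges, its vertex-hyperedge incidence matrix $M_G\in\{0,1\}^{n\times m}$ has $(i,j)$ entry $1$ iff vertex $i$ belongs to hyperedge $j$ (for a graph this is the usual vertex-edge incidence matrix). For hypergraphs $G,H$, write $G\equiv H$ if either $G$ and $H$ have the same number of vertices and no hyperedges, or there exist doubly stochastic matrices $S_1,S_2$ with $S_1M_G=M_HS_2^t$ and $M_GS_2=S_1^tM_H$.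
   Formalization: The doubly stochastic matrices, both the one witnessing $G\cong_f H$ and the two witnessing $G\equiv H$, have entries in ℚ. -}

module Defs where

open import Data.Nat using (ℕ; zero; suc)
open import Data.Fin using (Fin; zero; suc)
open import Data.Fin.Properties using (any?) renaming (_≟_ to _≟ᶠ_)
open import Data.Rational using (ℚ; 0ℚ; 1ℚ; _+_; _*_; _≤_)
open import Data.Product using (Σ; Σ-syntax; _×_; _,_; ∃)
open import Data.Sum using (_⊎_)
open import Relation.Binary.PropositionalEquality using (_≡_; _≢_)
open import Relation.Nullary using (Dec; yes; no; _×-dec_; _⊎-dec_)

Matrix : ℕ → ℕ → Set
Matrix a b = Fin a → Fin b → ℚ

sumF : ∀ {n} → (Fin n → ℚ) → ℚ
sumF {zero}  f = 0ℚ
sumF {suc n} f = f zero + sumF (λ i → f (suc i))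

infixl 7 _⊗_
_⊗_ : ∀ {a b c} → Matrix a b → Matrix b c → Matrix a c
(A ⊗ B) i k = sumF (λ j → A i j * B j k)

_ᵗ : ∀ {a b} → Matrix a b → Matrix b a
(A ᵗ) j i = A i j

IsDoublyStochastic : ∀ {a b} → Matrix a b → Set
IsDoublyStochastic {a} {b} S =
  (a ≡ b)
  × (∀ i j → 0ℚ ≤ S i j)
  × (∀ i → sumF (λ j → S i j) ≡ 1ℚ)
  × (∀ j → sumF (λ i → S i j) ≡ 1ℚ)

record Graph : Set where
  field
    n m     : ℕ
    src tgt : Fin m → Fin n
    loopless : ∀ k → src k ≢ tgt k
    simple   : ∀ k l →
      ((src k ≡ src l × tgt k ≡ tgt l) ⊎ (src k ≡ tgt l × tgt k ≡ src l)) →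
      k ≡ l
open Graph public

incident? : (G : Graph) (v : Fin (n G)) (k : Fin (m G)) → Dec ((v ≡ src G k) ⊎ (v ≡ tgt G k))
incident? G v k = (v ≟ᶠ src G k) ⊎-dec (v ≟ᶠ tgt G k)

adjacent? : (G : Graph) (i j : Fin (n G)) →
  Dec (∃ λ k → (i ≡ src G k × j ≡ tgt G k) ⊎ (i ≡ tgt G k × j ≡ src G k))
adjacent? G i j = any? (λ k →
  ((i ≟ᶠ src G k) ×-dec (j ≟ᶠ tgt G k)) ⊎-dec ((i ≟ᶠ tgt G k) ×-dec (j ≟ᶠ src G k)))

bit : ∀ {P : Set} → Dec P → ℚ
bit (yes _) = 1ℚ
bit (no _)  = 0ℚ

adjMatrix : (G : Graph) → Matrix (n G) (n G)
adjMatrix G i j = bit (adjacent? G i j)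

incMatrix : (G : Graph) → Matrix (n G) (m G)
incMatrix G v k = bit (incident? G v k)

FracIso : Graph → Graph → Set
FracIso G H = Σ[ S ∈ Matrix (n G) (n H) ]
  IsDoublyStochastic S × (∀ i j → (adjMatrix G ⊗ S) i j ≡ (S ⊗ adjMatrix H) i j)

IncEquiv : Graph → Graph → Set
IncEquiv G H =
  (n G ≡ n H × m G ≡ 0 × m H ≡ 0)
  ⊎ (Σ[ S₁ ∈ Matrix (n H) (n G) ] Σ[ S₂ ∈ Matrix (m G) (m H) ]
       IsDoublyStochastic S₁ × IsDoublyStochastic S₂
       × (∀ i k → (S₁ ⊗ incMatrix G) i k ≡ (incMatrix H ⊗ (S₂ ᵗ)) i k)
       × (∀ i k → (incMatrix G ⊗ S₂) i k ≡ ((S₁ ᵗ) ⊗ incMatrix H) i k))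

-- Colour refinement of the disjoint union of G and H, started from a fractional isomorphism S,
-- keeps the support of S inside the colour classes: if α = S β and β = Sᵗ α then α and β agree
-- wherever S is nonzero, since ∑ Sᵤₓ (αᵤ - βₓ)² = 0. The stable colouring is a common equitable
-- partition, and the matrix X that is uniform on each of its classes is a fractional isomorphism
-- with the extra symmetry (A X)ᵥₓ = (A X)ᵤᵧ whenever Xᵤₓ and Xᵥᵧ are nonzero. That symmetry lets
-- the oriented edge u → v go to x → y with weight Xᵤₓ Xᵥᵧ / (A X)ᵥₓ; symmetrising over both
-- orientations gives a doubly stochastic edge matrix which, with Xᵗ on the vertices, satisfies
-- both incidence equations.
module Submission where

open import Data.Bool using (Bool; true; false; _∧_; T; if_then_else_)
open import Data.Bool.Properties using (T-∧) renaming (_≟_ to _≟ᵇ_)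
open import Data.Empty using (⊥-elim)
open import Data.Fin using (Fin; zero; suc)
open import Data.Fin.Properties using (all?; ¬∀⟶∃¬; suc-injective; +↔⊎; *↔×)
  renaming (_≟_ to _≟ᶠ_)
open import Data.Maybe using (Maybe; just; nothing)
open import Data.Nat as ℕ using (ℕ; zero; suc)
import Data.Nat.Properties as ℕₚ
open import Data.Product using (Σ-syntax; _×_; _,_; proj₁; proj₂; ∃; uncurry)
open import Data.Product.Function.NonDependent.Propositional using (_×-↔_)
open import Data.Rational
  using (ℚ; 0ℚ; 1ℚ; _+_; _*_; _-_; -_; _≤_; _<_; 1/_; nonNegative; ≢-nonZero)
open import Data.Rational.Properties
open import Data.Sum using (_⊎_; inj₁; inj₂; [_,_])
open import Function using (_∘_; _↔_; Inverse; Equivalence)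
open import Function.Construct.Composition using (_↔-∘_)
open import Relation.Binary using (IsEquivalence)
open import Relation.Binary.PropositionalEquality
  using (_≡_; _≢_; refl; sym; trans; cong; cong₂; subst; module ≡-Reasoning)
open import Relation.Nullary using (Dec; yes; no; ¬_; _×-dec_; _⊎-dec_)
open import Relation.Nullary.Decidable using (⌊_⌋; toWitness; fromWitness; map′)
open import Tactic.RingSolver using (solve-∀)
open import Tactic.RingSolver.Core.AlmostCommutativeRing
  using (AlmostCommutativeRing; fromCommutativeRing)
open import Algebra.Properties.Group +-0-group using (x∙y⁻¹≈ε⇒x≈y; ∙-cancelˡ)

open import Defs

ℚ-ring : AlmostCommutativeRing _ _
ℚ-ring = fromCommutativeRing +-*-commutativeRing isZero
  where
  isZero : ∀ p → Maybe (0ℚ ≡ p)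
  isZero p with 0ℚ ≟ p
  ... | yes 0≡p = just 0≡p
  ... | no  _   = nothing

-- The reciprocal, with the junk value recip 0ℚ = 0ℚ.
recip : ℚ → ℚ
recip p with p ≟ 0ℚ
... | yes _   = 0ℚ
... | no  p≢0 = (1/ p) {{≢-nonZero p≢0}}

recip-inverseˡ : ∀ p → p ≢ 0ℚ → recip p * p ≡ 1ℚ
recip-inverseˡ p p≢0 with p ≟ 0ℚ
... | yes p≡0  = ⊥-elim (p≢0 p≡0)
... | no  p≢0′ = *-inverseˡ p {{≢-nonZero p≢0′}}

recip-inverseʳ : ∀ p → p ≢ 0ℚ → p * recip p ≡ 1ℚ
recip-inverseʳ p p≢0 = trans (*-comm p (recip p)) (recip-inverseˡ p p≢0)

*-nonNeg : ∀ {p q} → 0ℚ ≤ p → 0ℚ ≤ q → 0ℚ ≤ p * q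
*-nonNeg {p} {q} 0≤p 0≤q =
  nonNegative⁻¹ _ {{nonNeg*nonNeg⇒nonNeg p {{nonNegative 0≤p}} q {{nonNegative 0≤q}}}}

+-nonNeg : ∀ {p q} → 0ℚ ≤ p → 0ℚ ≤ q → 0ℚ ≤ p + q
+-nonNeg = +-mono-≤

recip-nonNeg : ∀ {p} → 0ℚ ≤ p → 0ℚ ≤ recip p
recip-nonNeg {p} 0≤p with p ≟ 0ℚ
... | yes _   = ≤-refl
... | no  p≢0 = nonNegative⁻¹ 1/p {{pos⇒nonNeg 1/p {{1/pos⇒pos p {{p>0}}}}}}
  where
  p>0 = nonNeg∧nonZero⇒pos p {{nonNegative 0≤p}} {{≢-nonZero p≢0}}
  1/p = (1/ p) {{≢-nonZero p≢0}}

0≤p≤q≡0⇒p≡0 : ∀ {p q} → 0ℚ ≤ p → p ≤ q → q ≡ 0ℚ → p ≡ 0ℚ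
0≤p≤q≡0⇒p≡0 0≤p p≤q q≡0 = ≤-antisym (≤-trans p≤q (≤-reflexive q≡0)) 0≤p

square-nonNeg : ∀ p → 0ℚ ≤ p * p
square-nonNeg p with ≤-total 0ℚ p
... | inj₁ 0≤p = *-nonNeg 0≤p 0≤p
... | inj₂ p≤0 = subst (0ℚ ≤_) (neg-square p) (*-nonNeg 0≤-p 0≤-p)
  where
  0≤-p : 0ℚ ≤ - p
  0≤-p = neg-antimono-≤ p≤0
  neg-square : ∀ p → (- p) * (- p) ≡ p * p
  neg-square = solve-∀ ℚ-ring

p*q≡0⇒q≡0 : ∀ p q → p ≢ 0ℚ → p * q ≡ 0ℚ → q ≡ 0ℚ
p*q≡0⇒q≡0 p q p≢0 pq≡0 = begin
  q                 ≡⟨ sym (*-identityˡ q) ⟩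
  1ℚ * q            ≡⟨ cong (_* q) (recip-inverseˡ p p≢0) ⟨
  recip p * p * q   ≡⟨ *-assoc (recip p) p q ⟩
  recip p * (p * q) ≡⟨ cong (recip p *_) pq≡0 ⟩
  recip p * 0ℚ      ≡⟨ *-zeroʳ (recip p) ⟩
  0ℚ                ∎
  where open ≡-Reasoning

p*p≡0⇒p≡0 : ∀ p → p * p ≡ 0ℚ → p ≡ 0ℚ
p*p≡0⇒p≡0 p pp≡0 with p ≟ 0ℚ
... | yes p≡0 = p≡0
... | no  p≢0 = p*q≡0⇒q≡0 p p p≢0 pp≡0

*-recip-cancelʳ : ∀ p q → (q ≡ 0ℚ → p ≡ 0ℚ) → p * recip q * q ≡ p
*-recip-cancelʳ p q q≡0⇒p≡0 with q ≟ 0ℚ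
... | yes q≡0 = trans (cong (_* q) (*-zeroʳ p)) (trans (*-zeroˡ q) (sym (q≡0⇒p≡0 q≡0)))
... | no  q≢0 = trans (*-assoc p _ q) (trans (cong (p *_) (*-inverseˡ q {{≢-nonZero q≢0}})) (*-identityʳ p))

cross-multiply : ∀ p q r s → p ≢ 0ℚ → q ≢ 0ℚ → p * r ≡ q * s → recip q * r ≡ recip p * s
cross-multiply p q r s p≢0 q≢0 pr≡qs = begin
  recip q * r                       ≡⟨ *-identityʳ _ ⟨
  recip q * r * 1ℚ                  ≡⟨ cong (recip q * r *_) (recip-inverseˡ p p≢0) ⟨
  recip q * r * (recip p * p)       ≡⟨ regroup (recip q) r (recip p) p ⟩
  recip q * recip p * (p * r)       ≡⟨ cong (recip q * recip p *_) pr≡qs ⟩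
  recip q * recip p * (q * s)       ≡⟨ regroup′ (recip q) (recip p) q s ⟩
  recip q * q * (recip p * s)       ≡⟨ cong (_* (recip p * s)) (recip-inverseˡ q q≢0) ⟩
  1ℚ * (recip p * s)                ≡⟨ *-identityˡ _ ⟩
  recip p * s                       ∎
  where
  open ≡-Reasoning
  regroup : ∀ a b c d → a * b * (c * d) ≡ a * c * (d * b)
  regroup = solve-∀ ℚ-ring
  regroup′ : ∀ a b c d → a * b * (c * d) ≡ a * c * (b * d)
  regroup′ = solve-∀ ℚ-ring

2*p≡2⇒p≡1 : ∀ p → (1ℚ + 1ℚ) * p ≡ 1ℚ + 1ℚ → p ≡ 1ℚ
2*p≡2⇒p≡1 p 2p≡2 = x∙y⁻¹≈ε⇒x≈y p 1ℚ (p*q≡0⇒q≡0 (1ℚ + 1ℚ) (p - 1ℚ) (λ ()) 2[p-1]≡0)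
  where
  expand : ∀ p → (1ℚ + 1ℚ) * (p - 1ℚ) ≡ (1ℚ + 1ℚ) * p - (1ℚ + 1ℚ)
  expand = solve-∀ ℚ-ring
  2[p-1]≡0 = trans (expand p) (trans (cong (_- (1ℚ + 1ℚ)) 2p≡2) (+-inverseʳ (1ℚ + 1ℚ)))

ι : ℕ → ℚ
ι zero    = 0ℚ
ι (suc k) = 1ℚ + ι k

ι-nonNeg : ∀ k → 0ℚ ≤ ι k
ι-nonNeg zero    = ≤-refl
ι-nonNeg (suc k) = +-nonNeg (nonNegative⁻¹ 1ℚ) (ι-nonNeg k)

ι-suc-pos : ∀ k → 0ℚ < ι (suc k)
ι-suc-pos k = +-mono-<-≤ (positive⁻¹ 1ℚ) (ι-nonNeg k)

ι-injective : ∀ {k l} → ι k ≡ ι l → k ≡ l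
ι-injective {zero}  {zero}  _  = refl
ι-injective {zero}  {suc l} eq = ⊥-elim (<⇒≢ (ι-suc-pos l) eq)
ι-injective {suc k} {zero}  eq = ⊥-elim (<⇒≢ (ι-suc-pos k) (sym eq))
ι-injective {suc k} {suc l} eq = cong suc (ι-injective (∙-cancelˡ 1ℚ (ι k) (ι l) eq))

χ : Bool → ℚ
χ true  = 1ℚ
χ false = 0ℚ

χ-nonNeg : ∀ b → 0ℚ ≤ χ b
χ-nonNeg true  = nonNegative⁻¹ 1ℚ
χ-nonNeg false = ≤-refl

χ-cong : ∀ {a b} → (T a → T b) → (T b → T a) → χ a ≡ χ b
χ-cong {true}  {true}  _   _   = refl
χ-cong {true}  {false} a⇒b _   = ⊥-elim (a⇒b _)
χ-cong {false} {true}  _   b⇒a = ⊥-elim (b⇒a _)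
χ-cong {false} {false} _   _   = refl

χ-true : ∀ {b} → T b → χ b ≡ 1ℚ
χ-true {true} _ = refl

χ*-cong : ∀ b {p q} → (T b → p ≡ q) → χ b * p ≡ χ b * q
χ*-cong true  {p} {q} p≡q = cong (1ℚ *_) (p≡q _)
χ*-cong false {p} {q} _   = trans (*-zeroˡ p) (sym (*-zeroˡ q))

χ≢0⇒T : ∀ b → χ b ≢ 0ℚ → T b
χ≢0⇒T true  _    = _
χ≢0⇒T false χ≢0 = ⊥-elim (χ≢0 refl)

χ*≢0⇒T : ∀ b p → χ b * p ≢ 0ℚ → T b
χ*≢0⇒T true  _ _    = _
χ*≢0⇒T false p χp≢0 = ⊥-elim (χp≢0 (*-zeroˡ p))

sumF-cong : ∀ {k} {f g : Fin k → ℚ} → (∀ i → f i ≡ g i) → sumF f ≡ sumF g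
sumF-cong {zero}  f≗g = refl
sumF-cong {suc k} f≗g = cong₂ _+_ (f≗g zero) (sumF-cong (f≗g ∘ suc))

sumF-zeros : ∀ {k} (f : Fin k → ℚ) → (∀ i → f i ≡ 0ℚ) → sumF f ≡ 0ℚ
sumF-zeros {zero}  f f≗0 = refl
sumF-zeros {suc k} f f≗0 = trans (cong₂ _+_ (f≗0 zero) (sumF-zeros (f ∘ suc) (f≗0 ∘ suc))) (+-identityˡ 0ℚ)

sumF-distrib-+ : ∀ {k} (f g : Fin k → ℚ) → sumF (λ i → f i + g i) ≡ sumF f + sumF g
sumF-distrib-+ {zero}  f g = sym (+-identityˡ 0ℚ)
sumF-distrib-+ {suc k} f g =
  trans (cong (f zero + g zero +_) (sumF-distrib-+ (f ∘ suc) (g ∘ suc)))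
        (interchange (f zero) (g zero) (sumF (f ∘ suc)) (sumF (g ∘ suc)))
  where
  interchange : ∀ a b c d → (a + b) + (c + d) ≡ (a + c) + (b + d)
  interchange = solve-∀ ℚ-ring

sumF-*ˡ : ∀ {k} c (f : Fin k → ℚ) → sumF (λ i → c * f i) ≡ c * sumF f
sumF-*ˡ {zero}  c f = sym (*-zeroʳ c)
sumF-*ˡ {suc k} c f = trans (cong (c * f zero +_) (sumF-*ˡ c (f ∘ suc))) (sym (*-distribˡ-+ c _ _))

sumF-*ʳ : ∀ {k} c (f : Fin k → ℚ) → sumF (λ i → f i * c) ≡ sumF f * c
sumF-*ʳ c f = trans (sumF-cong (λ i → *-comm (f i) c)) (trans (sumF-*ˡ c f) (*-comm c _))

sumF-neg : ∀ {k} (f : Fin k → ℚ) → sumF (λ i → - f i) ≡ - sumF f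
sumF-neg f = trans (sumF-cong (λ i → neg≡-1* (f i))) (trans (sumF-*ˡ (- 1ℚ) f) (sym (neg≡-1* _)))
  where
  neg≡-1* : ∀ p → - p ≡ (- 1ℚ) * p
  neg≡-1* = solve-∀ ℚ-ring

sumF-comm : ∀ {k l} (f : Fin k → Fin l → ℚ) →
  sumF (λ i → sumF (f i)) ≡ sumF (λ j → sumF (λ i → f i j))
sumF-comm {zero}  {l} f = sym (sumF-zeros {l} _ (λ _ → refl))
sumF-comm {suc k} {l} f =
  trans (cong (sumF (f zero) +_) (sumF-comm (f ∘ suc))) (sym (sumF-distrib-+ (f zero) _))

sumF-single : ∀ {k} (f : Fin k → ℚ) i → (∀ j → j ≢ i → f j ≡ 0ℚ) → sumF f ≡ f i
sumF-single {suc k} f zero    f≗0 =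
  trans (cong (f zero +_) (sumF-zeros (f ∘ suc) (λ j → f≗0 (suc j) λ ()))) (+-identityʳ (f zero))
sumF-single {suc k} f (suc i) f≗0 =
  trans (cong₂ _+_ (f≗0 zero λ ()) (sumF-single (f ∘ suc) i (λ j j≢i → f≗0 (suc j) (j≢i ∘ suc-injective))))
        (+-identityˡ (f (suc i)))

sumF-nonNeg : ∀ {k} (f : Fin k → ℚ) → (∀ i → 0ℚ ≤ f i) → 0ℚ ≤ sumF f
sumF-nonNeg {zero}  f f≥0 = ≤-refl
sumF-nonNeg {suc k} f f≥0 = +-nonNeg (f≥0 zero) (sumF-nonNeg (f ∘ suc) (f≥0 ∘ suc))

term≤sumF : ∀ {k} (f : Fin k → ℚ) → (∀ i → 0ℚ ≤ f i) → ∀ i → f i ≤ sumF f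
term≤sumF {suc k} f f≥0 zero    = ≤-trans (≤-reflexive (sym (+-identityʳ (f zero))))
                                          (+-monoʳ-≤ (f zero) (sumF-nonNeg (f ∘ suc) (f≥0 ∘ suc)))
term≤sumF {suc k} f f≥0 (suc i) = ≤-trans (term≤sumF (f ∘ suc) (f≥0 ∘ suc) i)
                                  (≤-trans (≤-reflexive (sym (+-identityˡ _))) (+-monoˡ-≤ _ (f≥0 zero)))

sumF≡0⇒term≡0 : ∀ {k} (f : Fin k → ℚ) → (∀ i → 0ℚ ≤ f i) → sumF f ≡ 0ℚ → ∀ i → f i ≡ 0ℚ
sumF≡0⇒term≡0 f f≥0 Σf≡0 i = 0≤p≤q≡0⇒p≡0 (f≥0 i) (term≤sumF f f≥0 i) Σf≡0

sumF≢0⇒term≢0 : ∀ {k} (f : Fin k → ℚ) → sumF f ≢ 0ℚ → ∃ λ i → f i ≢ 0ℚ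
sumF≢0⇒term≢0 {zero}  f Σf≢0 = ⊥-elim (Σf≢0 refl)
sumF≢0⇒term≢0 {suc k} f Σf≢0 with f zero ≟ 0ℚ
... | no  f₀≢0 = zero , f₀≢0
... | yes f₀≡0 with sumF≢0⇒term≢0 (f ∘ suc) (λ Σ≡0 → Σf≢0 (trans (cong₂ _+_ f₀≡0 Σ≡0) (+-identityˡ _)))
...   | i , fi≢0 = suc i , fi≢0

sumF-nonNeg-≢0 : ∀ {k} (f : Fin k → ℚ) → (∀ i → 0ℚ ≤ f i) → ∀ i → f i ≡ 1ℚ → sumF f ≢ 0ℚ
sumF-nonNeg-≢0 f f≥0 i fi≡1 Σf≡0 = 1≢0 (trans (sym fi≡1) (sumF≡0⇒term≡0 f f≥0 Σf≡0 i))

sumF-1≡ι : ∀ k → sumF {k} (λ _ → 1ℚ) ≡ ι k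
sumF-1≡ι zero    = refl
sumF-1≡ι (suc k) = cong (1ℚ +_) (sumF-1≡ι k)

infixl 7 _⊙_
_⊙_ : ∀ {a b} → Matrix a b → (Fin b → ℚ) → Fin a → ℚ
(M ⊙ v) i = sumF (λ j → M i j * v j)

⊙-⊙≡⊗-⊙ : ∀ {a b c} (M : Matrix a b) (N : Matrix b c) (v : Fin c → ℚ) i →
  (M ⊙ (N ⊙ v)) i ≡ ((M ⊗ N) ⊙ v) i
⊙-⊙≡⊗-⊙ M N v i = begin
  sumF (λ j → M i j * sumF (λ k → N j k * v k))    ≡⟨ sumF-cong (λ j → sumF-*ˡ (M i j) (λ k → N j k * v k)) ⟨
  sumF (λ j → sumF (λ k → M i j * (N j k * v k)))  ≡⟨ sumF-comm (λ j k → M i j * (N j k * v k)) ⟩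
  sumF (λ k → sumF (λ j → M i j * (N j k * v k)))  ≡⟨ sumF-cong (λ k → sumF-cong (λ j → *-assoc (M i j) (N j k) (v k))) ⟨
  sumF (λ k → sumF (λ j → M i j * N j k * v k))    ≡⟨ sumF-cong (λ k → sumF-*ʳ (v k) (λ j → M i j * N j k)) ⟩
  sumF (λ k → (M ⊗ N) i k * v k)                   ∎
  where open ≡-Reasoning

entries-nonNeg : ∀ {a b} {S : Matrix a b} → IsDoublyStochastic S → ∀ i j → 0ℚ ≤ S i j
entries-nonNeg (_ , S≥0 , _ , _) = S≥0

rows-sum-to-1 : ∀ {a b} {S : Matrix a b} → IsDoublyStochastic S → ∀ i → sumF (S i) ≡ 1ℚ
rows-sum-to-1 (_ , _ , rows , _) = rows

columns-sum-to-1 : ∀ {a b} {S : Matrix a b} → IsDoublyStochastic S → ∀ j → sumF (λ i → S i j) ≡ 1ℚ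
columns-sum-to-1 (_ , _ , _ , cols) = cols

-- Squareness is forced: both ways of summing all entries count the rows and the columns.
isDoublyStochastic : ∀ {a b} {S : Matrix a b} → (∀ i j → 0ℚ ≤ S i j) →
  (∀ i → sumF (S i) ≡ 1ℚ) → (∀ j → sumF (λ i → S i j) ≡ 1ℚ) → IsDoublyStochastic S
isDoublyStochastic {a} {b} {S} S≥0 rows cols = ι-injective a≡b , S≥0 , rows , cols
  where
  open ≡-Reasoning
  a≡b : ι a ≡ ι b
  a≡b = begin
    ι a                                ≡⟨ sumF-1≡ι a ⟨
    sumF {a} (λ _ → 1ℚ)                ≡⟨ sumF-cong rows ⟨
    sumF (λ i → sumF (S i))            ≡⟨ sumF-comm S ⟩
    sumF (λ j → sumF (λ i → S i j))    ≡⟨ sumF-cong cols ⟩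
    sumF {b} (λ _ → 1ℚ)                ≡⟨ sumF-1≡ι b ⟩
    ι b                                ∎

count : ∀ {k} → (Fin k → Bool) → ℕ
count {zero}  P = 0
count {suc k} P = (if P zero then 1 else 0) ℕ.+ count (P ∘ suc)

private
  if-mono : ∀ {a b} → (T a → T b) → (if a then 1 else 0) ℕ.≤ (if b then 1 else 0)
  if-mono {false}         _   = ℕ.z≤n
  if-mono {true}  {true}  _   = ℕₚ.≤-refl
  if-mono {true}  {false} a⇒b = ⊥-elim (a⇒b _)

  if-strict : ∀ {a b} → ¬ T a → T b → (if a then 1 else 0) ℕ.< (if b then 1 else 0)
  if-strict {true}          ¬a _ = ⊥-elim (¬a _)
  if-strict {false} {true}  _  _ = ℕₚ.≤-refl

count-mono : ∀ {k} {P Q : Fin k → Bool} → (∀ i → T (P i) → T (Q i)) → count P ℕ.≤ count Q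
count-mono {zero}  P⊆Q = ℕ.z≤n
count-mono {suc k} P⊆Q = ℕₚ.+-mono-≤ (if-mono (P⊆Q zero)) (count-mono (P⊆Q ∘ suc))

count-strict : ∀ {k} {P Q : Fin k → Bool} → (∀ i → T (P i) → T (Q i)) →
  ∀ i → ¬ T (P i) → T (Q i) → count P ℕ.< count Q
count-strict {suc k} P⊆Q zero    ¬Pi Qi = ℕₚ.+-mono-<-≤ (if-strict ¬Pi Qi) (count-mono (P⊆Q ∘ suc))
count-strict {suc k} P⊆Q (suc i) ¬Pi Qi = ℕₚ.+-mono-≤-< (if-mono (P⊆Q zero)) (count-strict (P⊆Q ∘ suc) i ¬Pi Qi)

-- Every step that changes the subset lowers its size, which cannot happen forever.
decreasing-stabilises : ∀ {W : Set} {k} → Fin k ↔ W → (P : ℕ → W → Bool) →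
  (∀ j w → T (P (suc j) w) → T (P j w)) → ∃ λ K → ∀ w → P (suc K) w ≡ P K w
decreasing-stabilises enum P decreasing = transfer (descend (suc (count (Pᶠ 0))) 0 (ℕₚ.n<1+n _))
  where
  open Inverse enum using (to; from; strictlyInverseˡ)

  Pᶠ : ℕ → Fin _ → Bool
  Pᶠ j = P j ∘ to

  dropped : ∀ {a b} → a ≢ b → (T a → T b) → ¬ T a × T b
  dropped {false} {false} a≢b _   = ⊥-elim (a≢b refl)
  dropped {false} {true}  _   _   = (λ ()) , _
  dropped {true}  {true}  a≢b _   = ⊥-elim (a≢b refl)
  dropped {true}  {false} _   a⇒b = ⊥-elim (a⇒b _)

  step : ∀ j → (∀ i → Pᶠ (suc j) i ≡ Pᶠ j i) ⊎ count (Pᶠ (suc j)) ℕ.< count (Pᶠ j)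
  step j with all? (λ i → Pᶠ (suc j) i ≟ᵇ Pᶠ j i)
  ... | yes unchanged = inj₁ unchanged
  ... | no  changed with ¬∀⟶∃¬ _ _ (λ i → Pᶠ (suc j) i ≟ᵇ Pᶠ j i) changed
  ...   | i , differs = inj₂ (count-strict (λ i → decreasing j (to i)) i (proj₁ lost) (proj₂ lost))
    where lost = dropped differs (decreasing j (to i))

  descend : ∀ bound j → count (Pᶠ j) ℕ.< bound → ∃ λ K → ∀ i → Pᶠ (suc K) i ≡ Pᶠ K i
  descend (suc bound) j count<bound with step j
  ... | inj₁ unchanged = j , unchanged
  ... | inj₂ fewer     = descend bound (suc j) (ℕₚ.<-≤-trans fewer (ℕ.s≤s⁻¹ count<bound))

  transfer : (∃ λ K → ∀ i → Pᶠ (suc K) i ≡ Pᶠ K i) → ∃ λ K → ∀ w → P (suc K) w ≡ P K w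
  transfer (K , unchanged) = K , λ w → subst (λ w → P (suc K) w ≡ P K w) (strictlyInverseˡ w) (unchanged (from w))

-- Vectors linked by a doubly stochastic matrix

AgreeOnSupport : ∀ {a b} → Matrix a b → (Fin a → ℚ) → (Fin b → ℚ) → Set
AgreeOnSupport S α β = ∀ i j → S i j ≢ 0ℚ → α i ≡ β j

module _ {a b} {S : Matrix a b} (S-ds : IsDoublyStochastic S) {α : Fin a → ℚ} {β : Fin b → ℚ} where

  private
    S*β≡S*α : AgreeOnSupport S α β → ∀ i j → S i j * β j ≡ S i j * α i
    S*β≡S*α α≈β i j with S i j ≟ 0ℚ
    ... | yes Sij≡0 = trans (cong (_* β j) Sij≡0)
                        (trans (*-zeroˡ (β j)) (sym (trans (cong (_* α i) Sij≡0) (*-zeroˡ (α i)))))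
    ... | no  Sij≢0 = cong (S i j *_) (sym (α≈β i j Sij≢0))

  agreeOnSupport⇒≡S⊙ : AgreeOnSupport S α β → ∀ i → α i ≡ (S ⊙ β) i
  agreeOnSupport⇒≡S⊙ α≈β i = begin
    α i                           ≡⟨ *-identityˡ (α i) ⟨
    1ℚ * α i                      ≡⟨ cong (_* α i) (rows-sum-to-1 S-ds i) ⟨
    sumF (S i) * α i              ≡⟨ sumF-*ʳ (α i) (S i) ⟨
    sumF (λ j → S i j * α i)      ≡⟨ sumF-cong (S*β≡S*α α≈β i) ⟨
    (S ⊙ β) i                     ∎
    where open ≡-Reasoning

  agreeOnSupport⇒≡Sᵗ⊙ : AgreeOnSupport S α β → ∀ j → β j ≡ (S ᵗ ⊙ α) j
  agreeOnSupport⇒≡Sᵗ⊙ α≈β j = begin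
    β j                           ≡⟨ *-identityˡ (β j) ⟨
    1ℚ * β j                      ≡⟨ cong (_* β j) (columns-sum-to-1 S-ds j) ⟨
    sumF (λ i → S i j) * β j      ≡⟨ sumF-*ʳ (β j) (λ i → S i j) ⟨
    sumF (λ i → S i j * β j)      ≡⟨ sumF-cong (λ i → S*β≡S*α α≈β i j) ⟩
    (S ᵗ ⊙ α) j                   ∎
    where open ≡-Reasoning

  agreeOnSupport⇒sumF≡ : AgreeOnSupport S α β → sumF α ≡ sumF β
  agreeOnSupport⇒sumF≡ α≈β = begin
    sumF α                                  ≡⟨ sumF-cong (agreeOnSupport⇒≡S⊙ α≈β) ⟩
    sumF (λ i → sumF (λ j → S i j * β j))   ≡⟨ sumF-comm (λ i j → S i j * β j) ⟩
    sumF (λ j → sumF (λ i → S i j * β j))   ≡⟨ sumF-cong (λ j → sumF-cong (λ i → S*β≡S*α α≈β i j)) ⟩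
    sumF (S ᵗ ⊙ α)                          ≡⟨ sumF-cong (agreeOnSupport⇒≡Sᵗ⊙ α≈β) ⟨
    sumF β                                  ∎
    where open ≡-Reasoning

  private
    deviation : Matrix a b
    deviation i j = S i j * ((α i - β j) * (α i - β j))

    deviation-nonNeg : ∀ i j → 0ℚ ≤ deviation i j
    deviation-nonNeg i j = *-nonNeg (entries-nonNeg S-ds i j) (square-nonNeg (α i - β j))

    -- Expanding the square: ∑ᵢⱼ Sᵢⱼ (αᵢ - βⱼ)² = ∑ⱼ βⱼ² - ∑ᵢ αᵢ², and ∑ᵢ αᵢ² = ∑ᵢⱼ αᵢ Sᵢⱼ βⱼ = ∑ⱼ βⱼ².
    total-deviation≡0 : (∀ i → α i ≡ (S ⊙ β) i) → (∀ j → β j ≡ (S ᵗ ⊙ α) j) →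
      sumF (λ i → sumF (deviation i)) ≡ 0ℚ
    total-deviation≡0 α≡Sβ β≡Sᵗα = begin
      sumF (λ i → sumF (deviation i))                 ≡⟨ sumF-cong row ⟩
      sumF (λ i → Sβ² i - α i * α i)                  ≡⟨ sumF-distrib-+ Sβ² (λ i → - (α i * α i)) ⟩
      sumF Sβ² + sumF (λ i → - (α i * α i))           ≡⟨ cong₂ _+_ ∑Sβ²≡∑β² (trans (sumF-neg (λ i → α i * α i))
                                                                                   (cong -_ ∑α²≡∑β²)) ⟩
      sumF (λ j → β j * β j) - sumF (λ j → β j * β j) ≡⟨ +-inverseʳ (sumF (λ j → β j * β j)) ⟩
      0ℚ                                              ∎
      where
      open ≡-Reasoning
      Sβ² : Fin a → ℚ
      Sβ² = S ⊙ (λ j → β j * β j)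

      row : ∀ i → sumF (deviation i) ≡ Sβ² i - α i * α i
      row i = begin
        sumF (deviation i)
          ≡⟨ sumF-cong (λ j → expand (S i j) (α i) (β j)) ⟩
        sumF (λ j → α i * α i * S i j + S i j * (β j * β j) + - (1ℚ + 1ℚ) * α i * (S i j * β j))
          ≡⟨ sumF-distrib-+ (λ j → α i * α i * S i j + S i j * (β j * β j)) _ ⟩
        sumF (λ j → α i * α i * S i j + S i j * (β j * β j)) + sumF (λ j → - (1ℚ + 1ℚ) * α i * (S i j * β j))
          ≡⟨ cong₂ _+_ (sumF-distrib-+ (λ j → α i * α i * S i j) _)
                       (sumF-*ˡ (- (1ℚ + 1ℚ) * α i) (λ j → S i j * β j)) ⟩
        sumF (λ j → α i * α i * S i j) + Sβ² i + - (1ℚ + 1ℚ) * α i * (S ⊙ β) i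
          ≡⟨ cong₂ (λ s t → s + Sβ² i + - (1ℚ + 1ℚ) * α i * t)
                   (trans (sumF-*ˡ (α i * α i) (S i)) (cong (α i * α i *_) (rows-sum-to-1 S-ds i)))
                   (sym (α≡Sβ i)) ⟩
        α i * α i * 1ℚ + Sβ² i + - (1ℚ + 1ℚ) * α i * α i
          ≡⟨ collect (α i) (Sβ² i) ⟩
        Sβ² i - α i * α i ∎
        where
        expand : ∀ s p q → s * ((p - q) * (p - q)) ≡ p * p * s + s * (q * q) + - (1ℚ + 1ℚ) * p * (s * q)
        expand = solve-∀ ℚ-ring
        collect : ∀ p r → p * p * 1ℚ + r + - (1ℚ + 1ℚ) * p * p ≡ r - p * p
        collect = solve-∀ ℚ-ring

      ∑Sβ²≡∑β² : sumF Sβ² ≡ sumF (λ j → β j * β j)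
      ∑Sβ²≡∑β² = trans (sumF-comm (λ i j → S i j * (β j * β j)))
        (sumF-cong (λ j → trans (sumF-*ʳ (β j * β j) (λ i → S i j))
                                (trans (cong (_* (β j * β j)) (columns-sum-to-1 S-ds j)) (*-identityˡ _))))

      ∑α²≡∑β² : sumF (λ i → α i * α i) ≡ sumF (λ j → β j * β j)
      ∑α²≡∑β² = begin
        sumF (λ i → α i * α i)                        ≡⟨ sumF-cong (λ i → cong (α i *_) (α≡Sβ i)) ⟩
        sumF (λ i → α i * (S ⊙ β) i)                  ≡⟨ sumF-cong (λ i → sumF-*ˡ (α i) (λ j → S i j * β j)) ⟨
        sumF (λ i → sumF (λ j → α i * (S i j * β j))) ≡⟨ sumF-comm (λ i j → α i * (S i j * β j)) ⟩
        sumF (λ j → sumF (λ i → α i * (S i j * β j))) ≡⟨ sumF-cong (λ j → trans (sumF-cong (λ i → reorder (α i) (S i j) (β j)))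
                                                                                (sumF-*ʳ (β j) (λ i → S i j * α i))) ⟩
        sumF (λ j → (S ᵗ ⊙ α) j * β j)                ≡⟨ sumF-cong (λ j → cong (_* β j) (β≡Sᵗα j)) ⟨
        sumF (λ j → β j * β j)                        ∎
        where
        reorder : ∀ p s q → p * (s * q) ≡ s * p * q
        reorder = solve-∀ ℚ-ring

  ≡S⊙⇒agreeOnSupport : (∀ i → α i ≡ (S ⊙ β) i) → (∀ j → β j ≡ (S ᵗ ⊙ α) j) → AgreeOnSupport S α β
  ≡S⊙⇒agreeOnSupport α≡Sβ β≡Sᵗα i j Sij≢0 =
    x∙y⁻¹≈ε⇒x≈y (α i) (β j) (p*p≡0⇒p≡0 _ (p*q≡0⇒q≡0 (S i j) _ Sij≢0 deviation≡0))
    where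
    row≡0 : sumF (deviation i) ≡ 0ℚ
    row≡0 = sumF≡0⇒term≡0 (λ i → sumF (deviation i)) (λ i → sumF-nonNeg (deviation i) (deviation-nonNeg i))
                          (total-deviation≡0 α≡Sβ β≡Sᵗα) i
    deviation≡0 : deviation i j ≡ 0ℚ
    deviation≡0 = sumF≡0⇒term≡0 (deviation i) (deviation-nonNeg i) row≡0 j

module _ {a b} {A : Matrix a a} {B : Matrix b b} {S : Matrix a b}
  (A-sym : ∀ i j → A i j ≡ A j i) (B-sym : ∀ i j → B i j ≡ B j i)
  (AS≡SB : ∀ i j → (A ⊗ S) i j ≡ (S ⊗ B) i j)
  {α : Fin a → ℚ} {β : Fin b → ℚ}
  where

  ⊙-intertwined : (∀ i → α i ≡ (S ⊙ β) i) → ∀ i → (A ⊙ α) i ≡ (S ⊙ (B ⊙ β)) i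
  ⊙-intertwined α≡Sβ i = begin
    (A ⊙ α) i             ≡⟨ sumF-cong (λ j → cong (A i j *_) (α≡Sβ j)) ⟩
    (A ⊙ (S ⊙ β)) i       ≡⟨ ⊙-⊙≡⊗-⊙ A S β i ⟩
    ((A ⊗ S) ⊙ β) i       ≡⟨ sumF-cong (λ j → cong (_* β j) (AS≡SB i j)) ⟩
    ((S ⊗ B) ⊙ β) i       ≡⟨ ⊙-⊙≡⊗-⊙ S B β i ⟨
    (S ⊙ (B ⊙ β)) i       ∎
    where open ≡-Reasoning

  ⊙ᵗ-intertwined : (∀ j → β j ≡ (S ᵗ ⊙ α) j) → ∀ j → (B ⊙ β) j ≡ (S ᵗ ⊙ (A ⊙ α)) j
  ⊙ᵗ-intertwined β≡Sᵗα j = begin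
    (B ⊙ β) j             ≡⟨ sumF-cong (λ k → cong (B j k *_) (β≡Sᵗα k)) ⟩
    (B ⊙ (S ᵗ ⊙ α)) j     ≡⟨ ⊙-⊙≡⊗-⊙ B (S ᵗ) α j ⟩
    ((B ⊗ S ᵗ) ⊙ α) j     ≡⟨ sumF-cong (λ i → cong (_* α i) (BSᵗ≡SᵗA j i)) ⟩
    ((S ᵗ ⊗ A) ⊙ α) j     ≡⟨ ⊙-⊙≡⊗-⊙ (S ᵗ) A α j ⟨
    (S ᵗ ⊙ (A ⊙ α)) j     ∎
    where
    open ≡-Reasoning
    BSᵗ≡SᵗA : ∀ j i → (B ⊗ S ᵗ) j i ≡ (S ᵗ ⊗ A) j i
    BSᵗ≡SᵗA j i = begin
      sumF (λ k → B j k * S i k)   ≡⟨ sumF-cong (λ k → trans (*-comm (B j k) (S i k)) (cong (S i k *_) (B-sym j k))) ⟩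
      (S ⊗ B) i j                  ≡⟨ AS≡SB i j ⟨
      sumF (λ k → A i k * S k j)   ≡⟨ sumF-cong (λ k → trans (*-comm (A i k) (S k j)) (cong (S k j *_) (A-sym i k))) ⟩
      (S ᵗ ⊗ A) j i                ∎

bit-nonNeg : ∀ {P : Set} (P? : Dec P) → 0ℚ ≤ bit P?
bit-nonNeg (yes _) = nonNegative⁻¹ 1ℚ
bit-nonNeg (no  _) = ≤-refl

bit-yes : ∀ {P : Set} (P? : Dec P) → P → bit P? ≡ 1ℚ
bit-yes (yes _) _ = refl
bit-yes (no ¬p) p = ⊥-elim (¬p p)

bit-no : ∀ {P : Set} (P? : Dec P) → ¬ P → bit P? ≡ 0ℚ
bit-no (yes p) ¬p = ⊥-elim (¬p p)
bit-no (no  _) _  = refl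

bit-cong : ∀ {P Q : Set} (P? : Dec P) (Q? : Dec Q) → (P → Q) → (Q → P) → bit P? ≡ bit Q?
bit-cong (yes _) (yes _) _   _   = refl
bit-cong (yes p) (no ¬q) p⇒q _   = ⊥-elim (¬q (p⇒q p))
bit-cong (no ¬p) (yes q) _   q⇒p = ⊥-elim (¬p (q⇒p q))
bit-cong (no  _) (no  _) _   _   = refl

δ : ∀ {k} → Fin k → Fin k → ℚ
δ i j = bit (i ≟ᶠ j)

sumF-δ : ∀ {k} (f : Fin k → ℚ) i → sumF (λ j → f j * δ j i) ≡ f i
sumF-δ f i =
  trans (sumF-single _ i (λ j j≢i → trans (cong (f j *_) (bit-no (j ≟ᶠ i) j≢i)) (*-zeroʳ (f j))))
        (trans (cong (f i *_) (bit-yes (i ≟ᶠ i) refl)) (*-identityʳ (f i)))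

module _ (G : Graph) where

  private
    A = adjMatrix G
    M = incMatrix G
    s = src G
    t = tgt G

  Joins : Fin (n G) → Fin (n G) → Fin (m G) → Set
  Joins u v k = (u ≡ s k × v ≡ t k) ⊎ (u ≡ t k × v ≡ s k)

  joins? : ∀ u v k → Dec (Joins u v k)
  joins? u v k = ((u ≟ᶠ s k) ×-dec (v ≟ᶠ t k)) ⊎-dec ((u ≟ᶠ t k) ×-dec (v ≟ᶠ s k))

  adjMatrix-sym : ∀ i j → A i j ≡ A j i
  adjMatrix-sym i j = bit-cong (adjacent? G i j) (adjacent? G j i) flip flip
    where
    flip : ∀ {u v} → ∃ (Joins u v) → ∃ (Joins v u)
    flip (k , inj₁ (u≡s , v≡t)) = k , inj₂ (v≡t , u≡s)
    flip (k , inj₂ (u≡t , v≡s)) = k , inj₁ (v≡s , u≡t)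

  adjMatrix-nonNeg : ∀ i j → 0ℚ ≤ A i j
  adjMatrix-nonNeg i j = bit-nonNeg (adjacent? G i j)

  adjMatrix-edge : ∀ k → A (s k) (t k) ≡ 1ℚ
  adjMatrix-edge k = bit-yes (adjacent? G (s k) (t k)) (k , inj₁ (refl , refl))

  incMatrix-column : ∀ (f : Fin (n G) → ℚ) k → sumF (λ w → f w * M w k) ≡ f (s k) + f (t k)
  incMatrix-column f k = begin
    sumF (λ w → f w * M w k)                          ≡⟨ sumF-cong (λ w → trans (cong (f w *_) (M≡δ+δ w)) (*-distribˡ-+ (f w) _ _)) ⟩
    sumF (λ w → f w * δ w (s k) + f w * δ w (t k))    ≡⟨ sumF-distrib-+ (λ w → f w * δ w (s k)) (λ w → f w * δ w (t k)) ⟩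
    _                                                 ≡⟨ cong₂ _+_ (sumF-δ f (s k)) (sumF-δ f (t k)) ⟩
    f (s k) + f (t k)                                 ∎
    where
    open ≡-Reasoning
    M≡δ+δ : ∀ w → M w k ≡ δ w (s k) + δ w (t k)
    M≡δ+δ w = cases (w ≟ᶠ s k) (w ≟ᶠ t k)
      where
      cases : Dec (w ≡ s k) → Dec (w ≡ t k) → M w k ≡ δ w (s k) + δ w (t k)
      cases (yes w≡s) (yes w≡t) = ⊥-elim (loopless G k (trans (sym w≡s) w≡t))
      cases (yes w≡s) (no  w≢t) = begin
        M w k                  ≡⟨ bit-yes (incident? G w k) (inj₁ w≡s) ⟩
        1ℚ + 0ℚ                ≡⟨ cong₂ _+_ (bit-yes (w ≟ᶠ s k) w≡s) (bit-no (w ≟ᶠ t k) w≢t) ⟨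
        δ w (s k) + δ w (t k)  ∎
      cases (no  w≢s) (yes w≡t) = begin
        M w k                  ≡⟨ bit-yes (incident? G w k) (inj₂ w≡t) ⟩
        0ℚ + 1ℚ                ≡⟨ cong₂ _+_ (bit-no (w ≟ᶠ s k) w≢s) (bit-yes (w ≟ᶠ t k) w≡t) ⟨
        δ w (s k) + δ w (t k)  ∎
      cases (no  w≢s) (no  w≢t) = begin
        M w k                  ≡⟨ bit-no (incident? G w k) [ w≢s , w≢t ] ⟩
        0ℚ + 0ℚ                ≡⟨ cong₂ _+_ (bit-no (w ≟ᶠ s k) w≢s) (bit-no (w ≟ᶠ t k) w≢t) ⟨
        δ w (s k) + δ w (t k)  ∎

  incMatrix-column-sum : ∀ k → sumF (λ w → M w k) ≡ 1ℚ + 1ℚ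
  incMatrix-column-sum k = trans (sumF-cong (λ w → sym (*-identityˡ (M w k)))) (incMatrix-column (λ _ → 1ℚ) k)

  private
    adjMatrix≡sumF-joins : ∀ u v → A u v ≡ sumF (λ k → bit (joins? u v k))
    adjMatrix≡sumF-joins u v with adjacent? G u v
    ... | yes (k , joins) = sym (trans (sumF-single _ k (λ l l≢k → bit-no (joins? u v l) (l≢k ∘ same-edge joins)))
                                       (bit-yes (joins? u v k) joins))
      where
      same-edge : ∀ {k l} → Joins u v k → Joins u v l → l ≡ k
      same-edge (inj₁ (u≡sk , v≡tk)) (inj₁ (u≡sl , v≡tl)) =
        simple G _ _ (inj₁ (trans (sym u≡sl) u≡sk , trans (sym v≡tl) v≡tk))
      same-edge (inj₁ (u≡sk , v≡tk)) (inj₂ (u≡tl , v≡sl)) =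
        simple G _ _ (inj₂ (trans (sym v≡sl) v≡tk , trans (sym u≡tl) u≡sk))
      same-edge (inj₂ (u≡tk , v≡sk)) (inj₁ (u≡sl , v≡tl)) =
        simple G _ _ (inj₂ (trans (sym u≡sl) u≡tk , trans (sym v≡tl) v≡sk))
      same-edge (inj₂ (u≡tk , v≡sk)) (inj₂ (u≡tl , v≡sl)) =
        simple G _ _ (inj₁ (trans (sym v≡sl) v≡sk , trans (sym u≡tl) u≡tk))
    ... | no ¬adj = sym (sumF-zeros _ (λ k → bit-no (joins? u v k) (λ joins → ¬adj (k , joins))))

    sumF-joins : (φ : Fin (n G) → Fin (n G) → ℚ) → (∀ u v → φ u v ≡ φ v u) → ∀ u k →
      sumF (λ v → bit (joins? u v k) * φ u v) ≡ M u k * φ (s k) (t k)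
    sumF-joins φ φ-sym u k = cases (u ≟ᶠ s k) (u ≟ᶠ t k)
      where
      open ≡-Reasoning
      goal = sumF (λ v → bit (joins? u v k) * φ u v) ≡ M u k * φ (s k) (t k)

      via-endpoint : ∀ w → (∀ v → bit (joins? u v k) ≡ δ v w) → φ u w ≡ φ (s k) (t k) →
        (u ≡ s k) ⊎ (u ≡ t k) → goal
      via-endpoint w joins≡δ φuw≡φst incident = begin
        sumF (λ v → bit (joins? u v k) * φ u v)   ≡⟨ sumF-cong (λ v → trans (*-comm _ (φ u v)) (cong (φ u v *_) (joins≡δ v))) ⟩
        sumF (λ v → φ u v * δ v w)                ≡⟨ sumF-δ (φ u) w ⟩
        φ u w                                     ≡⟨ φuw≡φst ⟩
        φ (s k) (t k)                             ≡⟨ *-identityˡ _ ⟨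
        1ℚ * φ (s k) (t k)                        ≡⟨ cong (_* φ (s k) (t k)) (bit-yes (incident? G u k) incident) ⟨
        M u k * φ (s k) (t k)                     ∎

      cases : Dec (u ≡ s k) → Dec (u ≡ t k) → goal
      cases (yes u≡s) (yes u≡t) = ⊥-elim (loopless G k (trans (sym u≡s) u≡t))
      cases (yes u≡s) (no  u≢t) = via-endpoint (t k)
        (λ v → bit-cong (joins? u v k) (v ≟ᶠ t k) [ proj₂ , ⊥-elim ∘ u≢t ∘ proj₁ ] (λ v≡t → inj₁ (u≡s , v≡t)))
        (cong (λ w → φ w (t k)) u≡s) (inj₁ u≡s)
      cases (no  u≢s) (yes u≡t) = via-endpoint (s k)
        (λ v → bit-cong (joins? u v k) (v ≟ᶠ s k) [ ⊥-elim ∘ u≢s ∘ proj₁ , proj₂ ] (λ v≡s → inj₂ (u≡t , v≡s)))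
        (trans (cong (λ w → φ w (s k)) u≡t) (φ-sym (t k) (s k))) (inj₂ u≡t)
      cases (no  u≢s) (no  u≢t) =
        trans (sumF-zeros _ (λ v → trans (cong (_* φ u v) (bit-no (joins? u v k) [ u≢s ∘ proj₁ , u≢t ∘ proj₁ ]))
                                         (*-zeroˡ (φ u v))))
              (sym (trans (cong (_* φ (s k) (t k)) (bit-no (incident? G u k) [ u≢s , u≢t ])) (*-zeroˡ (φ (s k) (t k)))))

  sumF-incMatrix≡sumF-adjMatrix : (φ : Fin (n G) → Fin (n G) → ℚ) → (∀ u v → φ u v ≡ φ v u) → ∀ u →
    sumF (λ k → M u k * φ (s k) (t k)) ≡ sumF (λ v → A u v * φ u v)
  sumF-incMatrix≡sumF-adjMatrix φ φ-sym u = begin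
    sumF (λ k → M u k * φ (s k) (t k))                    ≡⟨ sumF-cong (sumF-joins φ φ-sym u) ⟨
    sumF (λ k → sumF (λ v → bit (joins? u v k) * φ u v))  ≡⟨ sumF-comm (λ k v → bit (joins? u v k) * φ u v) ⟩
    sumF (λ v → sumF (λ k → bit (joins? u v k) * φ u v))  ≡⟨ sumF-cong (λ v → sumF-*ʳ (φ u v) (λ k → bit (joins? u v k))) ⟩
    sumF (λ v → sumF (λ k → bit (joins? u v k)) * φ u v)  ≡⟨ sumF-cong (λ v → cong (_* φ u v) (adjMatrix≡sumF-joins u v)) ⟨
    sumF (λ v → A u v * φ u v)                            ∎
    where open ≡-Reasoning

  sumF-incMatrix-⊙ : (f : Fin (m G) → ℚ) → sumF (M ⊙ f) ≡ (1ℚ + 1ℚ) * sumF f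
  sumF-incMatrix-⊙ f = begin
    sumF (λ w → sumF (λ k → M w k * f k))     ≡⟨ sumF-comm (λ w k → M w k * f k) ⟩
    sumF (λ k → sumF (λ w → M w k * f k))     ≡⟨ sumF-cong (λ k → sumF-*ʳ (f k) (λ w → M w k)) ⟩
    sumF (λ k → sumF (λ w → M w k) * f k)     ≡⟨ sumF-cong (λ k → cong (_* f k) (incMatrix-column-sum k)) ⟩
    sumF (λ k → (1ℚ + 1ℚ) * f k)              ≡⟨ sumF-*ˡ (1ℚ + 1ℚ) f ⟩
    (1ℚ + 1ℚ) * sumF f                        ∎
    where open ≡-Reasoning

-- Incidence equivalence from a balanced fractional isomorphism

module _ (G H : Graph) where

  private
    A = adjMatrix G
    B = adjMatrix H
    Mᴳ = incMatrix G
    Mᴴ = incMatrix H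

  Intertwines : Matrix (n G) (n H) → Set
  Intertwines X = ∀ i j → (A ⊗ X) i j ≡ (X ⊗ B) i j

  Balanced : Matrix (n G) (n H) → Set
  Balanced X = ∀ u v x y → X u x ≢ 0ℚ → X v y ≢ 0ℚ → (A ⊗ X) v x ≡ (A ⊗ X) u y

  module _ {X : Matrix (n G) (n H)} (X-ds : IsDoublyStochastic X) (AX≡XB : Intertwines X)
    (X-balanced : Balanced X) where

    private
      X≥0 = entries-nonNeg X-ds

      AX≥0 : ∀ v x → 0ℚ ≤ (A ⊗ X) v x
      AX≥0 v x = sumF-nonNeg _ (λ j → *-nonNeg (adjMatrix-nonNeg G v j) (X≥0 j x))

    -- The oriented edge u → v of G is sent to x → y of H with weight φ u v x y. Summing over y
    -- gives X u x because (X ⊗ B) v x = (A ⊗ X) v x; summing over v gives X u x because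
    -- (A ⊗ X) u y = (A ⊗ X) v x on the support, which is what balancedness provides.
    φ : Fin (n G) → Fin (n G) → Fin (n H) → Fin (n H) → ℚ
    φ u v x y = X u x * X v y * recip ((A ⊗ X) v x)

    φ-nonNeg : ∀ u v x y → 0ℚ ≤ φ u v x y
    φ-nonNeg u v x y = *-nonNeg (*-nonNeg (X≥0 u x) (X≥0 v y)) (recip-nonNeg (AX≥0 v x))

    φ-vanishes : ∀ u v x y → X u x ≡ 0ℚ ⊎ X v y ≡ 0ℚ → φ u v x y ≡ 0ℚ
    φ-vanishes u v x y (inj₁ Xux≡0) =
      trans (cong (λ z → z * X v y * r) Xux≡0) (trans (cong (_* r) (*-zeroˡ (X v y))) (*-zeroˡ r))
      where r = recip ((A ⊗ X) v x)
    φ-vanishes u v x y (inj₂ Xvy≡0) =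
      trans (cong (λ z → X u x * z * r) Xvy≡0) (trans (cong (_* r) (*-zeroʳ (X u x))) (*-zeroˡ r))
      where r = recip ((A ⊗ X) v x)

    φ-reverse : ∀ u v x y → φ u v x y ≡ φ v u y x
    φ-reverse u v x y with X u x ≟ 0ℚ | X v y ≟ 0ℚ
    ... | yes Xux≡0 | _         = trans (φ-vanishes u v x y (inj₁ Xux≡0)) (sym (φ-vanishes v u y x (inj₂ Xux≡0)))
    ... | no  _     | yes Xvy≡0 = trans (φ-vanishes u v x y (inj₂ Xvy≡0)) (sym (φ-vanishes v u y x (inj₁ Xvy≡0)))
    ... | no  Xux≢0 | no  Xvy≢0 = trans (cong (λ z → X u x * X v y * recip z) (X-balanced u v x y Xux≢0 Xvy≢0))
                                        (cong (_* recip ((A ⊗ X) u y)) (*-comm (X u x) (X v y)))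

    private
      X≤AX : ∀ {u v} x → A v u ≡ 1ℚ → X u x ≤ (A ⊗ X) v x
      X≤AX {u} {v} x Avu≡1 = ≤-trans (≤-reflexive (sym (trans (cong (_* X u x) Avu≡1) (*-identityˡ (X u x)))))
        (term≤sumF (λ j → A v j * X j x) (λ j → *-nonNeg (adjMatrix-nonNeg G v j) (X≥0 j x)) u)

      X≤XB : ∀ u {x y} → B x y ≡ 1ℚ → X u x ≤ (X ⊗ B) u y
      X≤XB u {x} {y} Bxy≡1 = ≤-trans (≤-reflexive (sym (trans (cong (X u x *_) Bxy≡1) (*-identityʳ (X u x)))))
        (term≤sumF (λ j → X u j * B j y) (λ j → *-nonNeg (X≥0 u j) (adjMatrix-nonNeg H j y)) x)

    φ-marginalᴴ : ∀ u v x → A v u ≡ 1ℚ → sumF (λ y → B x y * φ u v x y) ≡ X u x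
    φ-marginalᴴ u v x Avu≡1 = begin
      sumF (λ y → B x y * φ u v x y)                     ≡⟨ sumF-cong (λ y → trans (cong (_* φ u v x y) (adjMatrix-sym H x y))
                                                                                 (regroup (B y x) (X u x) (X v y) r)) ⟩
      sumF (λ y → X u x * r * (X v y * B y x))           ≡⟨ sumF-*ˡ (X u x * r) (λ y → X v y * B y x) ⟩
      X u x * r * (X ⊗ B) v x                            ≡⟨ cong (X u x * r *_) (AX≡XB v x) ⟨
      X u x * r * (A ⊗ X) v x                            ≡⟨ *-recip-cancelʳ (X u x) _ (0≤p≤q≡0⇒p≡0 (X≥0 u x) (X≤AX x Avu≡1)) ⟩
      X u x                                              ∎
      where
      open ≡-Reasoning
      r = recip ((A ⊗ X) v x)
      regroup : ∀ b p q r → b * (p * q * r) ≡ p * r * (q * b)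
      regroup = solve-∀ ℚ-ring

    φ-marginalᴳ : ∀ u x y → B x y ≡ 1ℚ → sumF (λ v → A u v * φ u v x y) ≡ X u x
    φ-marginalᴳ u x y Bxy≡1 = begin
      sumF (λ v → A u v * φ u v x y)                     ≡⟨ sumF-cong (λ v → trans (cong (A u v *_) (φ-reverse u v x y))
                                                                                 (regroup (A u v) (X v y) (X u x) r)) ⟩
      sumF (λ v → X u x * r * (A u v * X v y))           ≡⟨ sumF-*ˡ (X u x * r) (λ v → A u v * X v y) ⟩
      X u x * r * (A ⊗ X) u y                            ≡⟨ *-recip-cancelʳ (X u x) _
                                                              (0≤p≤q≡0⇒p≡0 (X≥0 u x) (X≤XB u Bxy≡1) ∘ trans (sym (AX≡XB u y))) ⟩
      X u x                                              ∎
      where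
      open ≡-Reasoning
      r = recip ((A ⊗ X) u y)
      regroup : ∀ a p q r → a * (p * q * r) ≡ q * r * (a * p)
      regroup = solve-∀ ℚ-ring

    ψ : Fin (n G) → Fin (n G) → Fin (n H) → Fin (n H) → ℚ
    ψ u v x y = φ u v x y + φ u v y x

    ψ-nonNeg : ∀ u v x y → 0ℚ ≤ ψ u v x y
    ψ-nonNeg u v x y = +-nonNeg (φ-nonNeg u v x y) (φ-nonNeg u v y x)

    ψ-symᴳ : ∀ u v x y → ψ u v x y ≡ ψ v u x y
    ψ-symᴳ u v x y = trans (cong₂ _+_ (φ-reverse u v x y) (φ-reverse u v y x)) (+-comm (φ v u y x) (φ v u x y))

    ψ-symᴴ : ∀ u v x y → ψ u v x y ≡ ψ u v y x
    ψ-symᴴ u v x y = +-comm (φ u v x y) (φ u v y x)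

    ψ-marginalᴴ : ∀ u v x → A u v ≡ 1ℚ → sumF (λ y → B x y * ψ u v x y) ≡ X u x + X v x
    ψ-marginalᴴ u v x Auv≡1 = begin
      sumF (λ y → B x y * ψ u v x y)
        ≡⟨ sumF-cong (λ y → *-distribˡ-+ (B x y) (φ u v x y) (φ u v y x)) ⟩
      sumF (λ y → B x y * φ u v x y + B x y * φ u v y x)
        ≡⟨ sumF-distrib-+ (λ y → B x y * φ u v x y) (λ y → B x y * φ u v y x) ⟩
      sumF (λ y → B x y * φ u v x y) + sumF (λ y → B x y * φ u v y x)
        ≡⟨ cong (sumF (λ y → B x y * φ u v x y) +_) (sumF-cong (λ y → cong (B x y *_) (φ-reverse u v y x))) ⟩
      sumF (λ y → B x y * φ u v x y) + sumF (λ y → B x y * φ v u x y)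
        ≡⟨ cong₂ _+_ (φ-marginalᴴ u v x (trans (adjMatrix-sym G v u) Auv≡1)) (φ-marginalᴴ v u x Auv≡1) ⟩
      X u x + X v x ∎
      where open ≡-Reasoning

    ψ-marginalᴳ : ∀ u x y → B x y ≡ 1ℚ → sumF (λ v → A u v * ψ u v x y) ≡ X u x + X u y
    ψ-marginalᴳ u x y Bxy≡1 = begin
      sumF (λ v → A u v * ψ u v x y)
        ≡⟨ sumF-cong (λ v → *-distribˡ-+ (A u v) (φ u v x y) (φ u v y x)) ⟩
      sumF (λ v → A u v * φ u v x y + A u v * φ u v y x)
        ≡⟨ sumF-distrib-+ (λ v → A u v * φ u v x y) (λ v → A u v * φ u v y x) ⟩
      sumF (λ v → A u v * φ u v x y) + sumF (λ v → A u v * φ u v y x)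
        ≡⟨ cong₂ _+_ (φ-marginalᴳ u x y Bxy≡1) (φ-marginalᴳ u y x (trans (adjMatrix-sym H y x) Bxy≡1)) ⟩
      X u x + X u y ∎
      where open ≡-Reasoning

    edgeMatrix : Matrix (m G) (m H)
    edgeMatrix e f = ψ (src G e) (tgt G e) (src H f) (tgt H f)

    Xᵗ⊗Mᴳ≡Mᴴ⊗edgeMatrixᵗ : ∀ x e → (X ᵗ ⊗ Mᴳ) x e ≡ (Mᴴ ⊗ edgeMatrix ᵗ) x e
    Xᵗ⊗Mᴳ≡Mᴴ⊗edgeMatrixᵗ x e = begin
      (X ᵗ ⊗ Mᴳ) x e                     ≡⟨ incMatrix-column G (λ w → X w x) e ⟩
      X (src G e) x + X (tgt G e) x      ≡⟨ ψ-marginalᴴ (src G e) (tgt G e) x (adjMatrix-edge G e) ⟨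
      sumF (λ y → B x y * ψ (src G e) (tgt G e) x y)
        ≡⟨ sumF-incMatrix≡sumF-adjMatrix H (ψ (src G e) (tgt G e)) (ψ-symᴴ (src G e) (tgt G e)) x ⟨
      (Mᴴ ⊗ edgeMatrix ᵗ) x e            ∎
      where open ≡-Reasoning

    Mᴳ⊗edgeMatrix≡X⊗Mᴴ : ∀ w f → (Mᴳ ⊗ edgeMatrix) w f ≡ (X ⊗ Mᴴ) w f
    Mᴳ⊗edgeMatrix≡X⊗Mᴴ w f = begin
      (Mᴳ ⊗ edgeMatrix) w f
        ≡⟨ sumF-incMatrix≡sumF-adjMatrix G (λ u v → ψ u v (src H f) (tgt H f)) (λ u v → ψ-symᴳ u v _ _) w ⟩
      sumF (λ v → A w v * ψ w v (src H f) (tgt H f))  ≡⟨ ψ-marginalᴳ w (src H f) (tgt H f) (adjMatrix-edge H f) ⟩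
      X w (src H f) + X w (tgt H f)                   ≡⟨ incMatrix-column H (X w) f ⟨
      (X ⊗ Mᴴ) w f                                    ∎
      where open ≡-Reasoning

    edgeMatrix-rows : ∀ e → sumF (edgeMatrix e) ≡ 1ℚ
    edgeMatrix-rows e = 2*p≡2⇒p≡1 _ (begin
      (1ℚ + 1ℚ) * sumF (edgeMatrix e)                    ≡⟨ sumF-incMatrix-⊙ H (edgeMatrix e) ⟨
      sumF (λ x → (Mᴴ ⊗ edgeMatrix ᵗ) x e)               ≡⟨ sumF-cong (λ x → Xᵗ⊗Mᴳ≡Mᴴ⊗edgeMatrixᵗ x e) ⟨
      sumF (λ x → (X ᵗ ⊗ Mᴳ) x e)                        ≡⟨ sumF-cong (λ x → incMatrix-column G (λ w → X w x) e) ⟩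
      sumF (λ x → X (src G e) x + X (tgt G e) x)         ≡⟨ sumF-distrib-+ (X (src G e)) (X (tgt G e)) ⟩
      sumF (X (src G e)) + sumF (X (tgt G e))            ≡⟨ cong₂ _+_ (rows-sum-to-1 X-ds _) (rows-sum-to-1 X-ds _) ⟩
      1ℚ + 1ℚ                                            ∎)
      where open ≡-Reasoning

    edgeMatrix-columns : ∀ f → sumF (λ e → edgeMatrix e f) ≡ 1ℚ
    edgeMatrix-columns f = 2*p≡2⇒p≡1 _ (begin
      (1ℚ + 1ℚ) * sumF (λ e → edgeMatrix e f)            ≡⟨ sumF-incMatrix-⊙ G (λ e → edgeMatrix e f) ⟨
      sumF (λ w → (Mᴳ ⊗ edgeMatrix) w f)                 ≡⟨ sumF-cong (λ w → Mᴳ⊗edgeMatrix≡X⊗Mᴴ w f) ⟩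
      sumF (λ w → (X ⊗ Mᴴ) w f)                          ≡⟨ sumF-cong (λ w → incMatrix-column H (X w) f) ⟩
      sumF (λ w → X w (src H f) + X w (tgt H f))         ≡⟨ sumF-distrib-+ (λ w → X w (src H f)) (λ w → X w (tgt H f)) ⟩
      sumF (λ w → X w (src H f)) + sumF (λ w → X w (tgt H f))
                                                         ≡⟨ cong₂ _+_ (columns-sum-to-1 X-ds _) (columns-sum-to-1 X-ds _) ⟩
      1ℚ + 1ℚ                                            ∎)
      where open ≡-Reasoning

    balanced⇒incEquiv : IncEquiv G H
    balanced⇒incEquiv =
      inj₂ (X ᵗ , edgeMatrix , Xᵗ-ds , edgeMatrix-ds , Xᵗ⊗Mᴳ≡Mᴴ⊗edgeMatrixᵗ , Mᴳ⊗edgeMatrix≡X⊗Mᴴ)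
      where
      Xᵗ-ds = isDoublyStochastic (λ x w → X≥0 w x) (columns-sum-to-1 X-ds) (rows-sum-to-1 X-ds)
      edgeMatrix-ds = isDoublyStochastic (λ e f → ψ-nonNeg _ _ _ _) edgeMatrix-rows edgeMatrix-columns

  -- Common equitable partitions

  Vertex : Set
  Vertex = Fin (n G) ⊎ Fin (n H)

  Relation : Set
  Relation = Vertex → Vertex → Bool

  degreeInto : Relation → Vertex → Vertex → ℚ
  degreeInto R (inj₁ u) r = (A ⊙ (λ w → χ (R (inj₁ w) r))) u
  degreeInto R (inj₂ x) r = (B ⊙ (λ y → χ (R (inj₂ y) r))) x

  sizeᴳ : Relation → Vertex → ℚ
  sizeᴳ R p = sumF (λ w → χ (R p (inj₁ w)))

  sizeᴴ : Relation → Vertex → ℚ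
  sizeᴴ R p = sumF (λ x → χ (R p (inj₂ x)))

  record CommonEquitablePartition : Set where
    field
      _∼_           : Relation
      isEquivalence : IsEquivalence (λ p q → T (p ∼ q))
      equitable     : ∀ {p q} → T (p ∼ q) → ∀ r → degreeInto _∼_ p r ≡ degreeInto _∼_ q r
      sizes-agree   : ∀ p → sizeᴳ _∼_ p ≡ sizeᴴ _∼_ p

  module _ (P : CommonEquitablePartition) where

    open CommonEquitablePartition P
    open IsEquivalence isEquivalence using () renaming (refl to ∼-refl; sym to ∼-sym; trans to ∼-trans)

    private
      deg : Vertex → Vertex → ℚ
      deg = degreeInto _∼_

      χ-sym : ∀ p q → χ (p ∼ q) ≡ χ (q ∼ p)
      χ-sym p q = χ-cong ∼-sym ∼-sym

      χ-congˡ : ∀ {p p′} → T (p ∼ p′) → ∀ q → χ (p ∼ q) ≡ χ (p′ ∼ q)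
      χ-congˡ p∼p′ q = χ-cong (∼-trans (∼-sym p∼p′)) (∼-trans p∼p′)

      χ-congʳ : ∀ {r r′} → T (r ∼ r′) → ∀ q → χ (q ∼ r) ≡ χ (q ∼ r′)
      χ-congʳ r∼r′ q = χ-cong (λ q∼r → ∼-trans q∼r r∼r′) (λ q∼r′ → ∼-trans q∼r′ (∼-sym r∼r′))

      deg-congʳ : ∀ p {r r′} → T (r ∼ r′) → deg p r ≡ deg p r′
      deg-congʳ (inj₁ u) r∼r′ = sumF-cong (λ w → cong (A u w *_) (χ-congʳ r∼r′ (inj₁ w)))
      deg-congʳ (inj₂ x) r∼r′ = sumF-cong (λ y → cong (B x y *_) (χ-congʳ r∼r′ (inj₂ y)))

      size : Vertex → ℚ
      size = sizeᴴ _∼_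

      size-cong : ∀ {p p′} → T (p ∼ p′) → size p ≡ size p′
      size-cong p∼p′ = sumF-cong (λ x → χ-congˡ p∼p′ (inj₂ x))

      size≢0 : ∀ p → size p ≢ 0ℚ
      size≢0 (inj₁ u) size≡0 =
        sumF-nonNeg-≢0 _ (λ w → χ-nonNeg (inj₁ u ∼ inj₁ w)) u (χ-true (∼-refl {inj₁ u}))
                       (trans (sizes-agree (inj₁ u)) size≡0)
      size≢0 (inj₂ x) = sumF-nonNeg-≢0 _ (λ y → χ-nonNeg (inj₂ x ∼ inj₂ y)) x (χ-true (∼-refl {inj₂ x}))

      -- Counting the edges of G from the class of v to the class of w in two ways.
      double-count : ∀ v w → size (inj₁ v) * deg (inj₁ v) (inj₁ w) ≡ size (inj₁ w) * deg (inj₁ w) (inj₁ v)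
      double-count v w = begin
        size (inj₁ v) * deg (inj₁ v) (inj₁ w)           ≡⟨ count-from v w ⟨
        edges v w                                       ≡⟨ sumF-comm (λ a b → a ∈ v * (A a b * b ∈ w)) ⟩
        sumF (λ b → sumF (λ a → a ∈ v * (A a b * b ∈ w))) ≡⟨ sumF-cong (λ b → sumF-cong (λ a → regroup b a)) ⟩
        edges w v                                       ≡⟨ count-from w v ⟩
        size (inj₁ w) * deg (inj₁ w) (inj₁ v)           ∎
        where
        open ≡-Reasoning
        infix 8 _∈_
        _∈_ : Fin (n G) → Fin (n G) → ℚ
        a ∈ v = χ (inj₁ a ∼ inj₁ v)

        edges : Fin (n G) → Fin (n G) → ℚ
        edges v w = sumF (λ a → sumF (λ b → a ∈ v * (A a b * b ∈ w)))

        regroup : ∀ b a → a ∈ v * (A a b * b ∈ w) ≡ b ∈ w * (A b a * a ∈ v)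
        regroup b a = trans (cong (λ z → a ∈ v * (z * b ∈ w)) (adjMatrix-sym G a b)) (swap (a ∈ v) (A b a) (b ∈ w))
          where
          swap : ∀ p q r → p * (q * r) ≡ r * (q * p)
          swap = solve-∀ ℚ-ring

        count-from : ∀ v w → edges v w ≡ size (inj₁ v) * deg (inj₁ v) (inj₁ w)
        count-from v w = begin
          edges v w                                   ≡⟨ sumF-cong (λ a → sumF-*ˡ (a ∈ v) (λ b → A a b * b ∈ w)) ⟩
          sumF (λ a → a ∈ v * deg (inj₁ a) (inj₁ w))  ≡⟨ sumF-cong (λ a → χ*-cong (inj₁ a ∼ inj₁ v)
                                                                                (λ a∼v → equitable a∼v (inj₁ w))) ⟩
          sumF (λ a → a ∈ v * deg (inj₁ v) (inj₁ w))  ≡⟨ sumF-*ʳ _ (λ a → a ∈ v) ⟩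
          sumF (λ a → a ∈ v) * deg (inj₁ v) (inj₁ w)  ≡⟨ cong (_* deg (inj₁ v) (inj₁ w)) (sumF-cong (λ a → χ-sym (inj₁ a) (inj₁ v))) ⟩
          sizeᴳ _∼_ (inj₁ v) * deg (inj₁ v) (inj₁ w)  ≡⟨ cong (_* deg (inj₁ v) (inj₁ w)) (sizes-agree (inj₁ v)) ⟩
          size (inj₁ v) * deg (inj₁ v) (inj₁ w)       ∎

    partitionMatrix : Matrix (n G) (n H)
    partitionMatrix u x = χ (inj₁ u ∼ inj₂ x) * recip (size (inj₁ u))

    private
      X = partitionMatrix

      X-rows : ∀ u → sumF (X u) ≡ 1ℚ
      X-rows u = trans (sumF-*ʳ (recip (size (inj₁ u))) (λ x → χ (inj₁ u ∼ inj₂ x)))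
                       (recip-inverseʳ _ (size≢0 (inj₁ u)))

      X-columns : ∀ x → sumF (λ u → X u x) ≡ 1ℚ
      X-columns x = begin
        sumF (λ u → χ (inj₁ u ∼ inj₂ x) * recip (size (inj₁ u)))
          ≡⟨ sumF-cong (λ u → χ*-cong (inj₁ u ∼ inj₂ x) (cong recip ∘ size-cong)) ⟩
        sumF (λ u → χ (inj₁ u ∼ inj₂ x) * recip (size (inj₂ x)))
          ≡⟨ sumF-*ʳ _ (λ u → χ (inj₁ u ∼ inj₂ x)) ⟩
        sumF (λ u → χ (inj₁ u ∼ inj₂ x)) * recip (size (inj₂ x))
          ≡⟨ cong (_* recip (size (inj₂ x))) (trans (sumF-cong (λ u → χ-sym (inj₁ u) (inj₂ x))) (sizes-agree (inj₂ x))) ⟩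
        size (inj₂ x) * recip (size (inj₂ x))
          ≡⟨ recip-inverseʳ _ (size≢0 (inj₂ x)) ⟩
        1ℚ ∎
        where open ≡-Reasoning

      X-nonNeg : ∀ u x → 0ℚ ≤ X u x
      X-nonNeg u x =
        *-nonNeg (χ-nonNeg (inj₁ u ∼ inj₂ x)) (recip-nonNeg (sumF-nonNeg _ (λ y → χ-nonNeg (inj₁ u ∼ inj₂ y))))

      A⊗X : ∀ v x → (A ⊗ X) v x ≡ recip (size (inj₂ x)) * deg (inj₁ v) (inj₂ x)
      A⊗X v x = trans (sumF-cong term) (sumF-*ˡ (recip (size (inj₂ x))) (λ w → A v w * χ (inj₁ w ∼ inj₂ x)))
        where
        regroup : ∀ a c r → a * (c * r) ≡ r * (a * c)
        regroup = solve-∀ ℚ-ring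
        term : ∀ w → A v w * X w x ≡ recip (size (inj₂ x)) * (A v w * χ (inj₁ w ∼ inj₂ x))
        term w = trans (cong (A v w *_) (χ*-cong (inj₁ w ∼ inj₂ x) (cong recip ∘ size-cong)))
                       (regroup (A v w) (χ (inj₁ w ∼ inj₂ x)) _)

      X⊗B : ∀ v x → (X ⊗ B) v x ≡ recip (size (inj₁ v)) * deg (inj₂ x) (inj₁ v)
      X⊗B v x = trans (sumF-cong term) (sumF-*ˡ (recip (size (inj₁ v))) (λ y → B x y * χ (inj₂ y ∼ inj₁ v)))
        where
        regroup : ∀ c r b → c * r * b ≡ r * (b * c)
        regroup = solve-∀ ℚ-ring
        term : ∀ y → X v y * B y x ≡ recip (size (inj₁ v)) * (B x y * χ (inj₂ y ∼ inj₁ v))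
        term y = trans (regroup (χ (inj₁ v ∼ inj₂ y)) _ (B y x))
                       (cong₂ (λ b c → recip (size (inj₁ v)) * (b * c)) (adjMatrix-sym H y x) (χ-sym (inj₁ v) (inj₂ y)))

      A⊗X-via : ∀ v x w → T (inj₁ w ∼ inj₂ x) →
        (A ⊗ X) v x ≡ recip (size (inj₁ w)) * deg (inj₁ v) (inj₁ w)
      A⊗X-via v x w w∼x = trans (A⊗X v x)
        (cong₂ (λ s d → recip s * d) (size-cong (∼-sym w∼x)) (deg-congʳ (inj₁ v) (∼-sym w∼x)))

      reciprocity : ∀ v w → recip (size (inj₁ w)) * deg (inj₁ v) (inj₁ w)
                          ≡ recip (size (inj₁ v)) * deg (inj₁ w) (inj₁ v)
      reciprocity v w = cross-multiply _ _ _ _ (size≢0 (inj₁ v)) (size≢0 (inj₁ w)) (double-count v w)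

      X-intertwines : Intertwines X
      X-intertwines v x = begin
        (A ⊗ X) v x                                    ≡⟨ A⊗X-via v x w w∼x ⟩
        recip (size (inj₁ w)) * deg (inj₁ v) (inj₁ w)  ≡⟨ reciprocity v w ⟩
        recip (size (inj₁ v)) * deg (inj₁ w) (inj₁ v)  ≡⟨ cong (recip (size (inj₁ v)) *_) (equitable w∼x (inj₁ v)) ⟩
        recip (size (inj₁ v)) * deg (inj₂ x) (inj₁ v)  ≡⟨ X⊗B v x ⟨
        (X ⊗ B) v x                                    ∎
        where
        open ≡-Reasoning
        member : ∃ λ w → χ (inj₂ x ∼ inj₁ w) ≢ 0ℚ
        member = sumF≢0⇒term≢0 _ (λ sizeᴳ≡0 → size≢0 (inj₂ x) (trans (sym (sizes-agree (inj₂ x))) sizeᴳ≡0))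
        w = proj₁ member
        w∼x = ∼-sym (χ≢0⇒T _ (proj₂ member))

      X-balanced : Balanced X
      X-balanced u v x y Xux≢0 Xvy≢0 = begin
        (A ⊗ X) v x                                    ≡⟨ A⊗X-via v x u (χ*≢0⇒T _ _ Xux≢0) ⟩
        recip (size (inj₁ u)) * deg (inj₁ v) (inj₁ u)  ≡⟨ reciprocity v u ⟩
        recip (size (inj₁ v)) * deg (inj₁ u) (inj₁ v)  ≡⟨ A⊗X-via u y v (χ*≢0⇒T _ _ Xvy≢0) ⟨
        (A ⊗ X) u y                                    ∎
        where open ≡-Reasoning

    commonEquitablePartition⇒balanced :
      Σ[ X ∈ Matrix (n G) (n H) ] IsDoublyStochastic X × Intertwines X × Balanced X
    commonEquitablePartition⇒balanced =
      X , isDoublyStochastic X-nonNeg X-rows X-columns , X-intertwines , X-balanced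

  -- Colour refinement

  all?ⱽ : {P : Vertex → Set} → (∀ p → Dec (P p)) → Dec (∀ p → P p)
  all?ⱽ P? = map′ (λ (allᴳ , allᴴ) → [ allᴳ , allᴴ ]) (λ all → all ∘ inj₁ , all ∘ inj₂)
                  (all? (P? ∘ inj₁) ×-dec all? (P? ∘ inj₂))

  refine : Relation → Relation
  refine R p q = R p q ∧ ⌊ all?ⱽ (λ r → degreeInto R p r ≟ degreeInto R q r) ⌋

  refine⇒ : ∀ R p q → T (refine R p q) → T (R p q) × (∀ r → degreeInto R p r ≡ degreeInto R q r)
  refine⇒ R p q refined with Equivalence.to T-∧ refined
  ... | Rpq , same = Rpq , toWitness same

  ⇒refine : ∀ R p q → T (R p q) → (∀ r → degreeInto R p r ≡ degreeInto R q r) → T (refine R p q)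
  ⇒refine R p q Rpq same = Equivalence.from T-∧ (Rpq , fromWitness same)

  refine-isEquivalence : ∀ {R} → IsEquivalence (λ p q → T (R p q)) → IsEquivalence (λ p q → T (refine R p q))
  refine-isEquivalence {R} R-equiv = record
    { refl  = λ {p} → ⇒refine R p p R.refl (λ _ → refl)
    ; sym   = λ {p} {q} refined → let (Rpq , same) = refine⇒ R p q refined
                                  in ⇒refine R q p (R.sym Rpq) (sym ∘ same)
    ; trans = λ {p} {q} {r} refined₁ refined₂ → let (Rpq , same₁) = refine⇒ R p q refined₁
                                                    (Rqr , same₂) = refine⇒ R q r refined₂
                                                in ⇒refine R p r (R.trans Rpq Rqr) (λ s → trans (same₁ s) (same₂ s))
    }
    where module R = IsEquivalence R-equiv

  refinement : ℕ → Relation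
  refinement zero    _ _ = true
  refinement (suc k) = refine (refinement k)

  refinement-isEquivalence : ∀ k → IsEquivalence (λ p q → T (refinement k p q))
  refinement-isEquivalence zero    = record { refl = _ ; sym = λ _ → _ ; trans = λ _ _ → _ }
  refinement-isEquivalence (suc k) = refine-isEquivalence (refinement-isEquivalence k)

  module _ {S : Matrix (n G) (n H)} (S-ds : IsDoublyStochastic S) (AS≡SB : Intertwines S) where

    private
      Supported : Relation → Set
      Supported R = ∀ u x → S u x ≢ 0ℚ → T (R (inj₁ u) (inj₂ x))

      membership-agrees : ∀ {R} → IsEquivalence (λ p q → T (R p q)) → Supported R → ∀ p →
        AgreeOnSupport S (λ w → χ (R p (inj₁ w))) (λ x → χ (R p (inj₂ x)))
      membership-agrees R-equiv supported p w x Swx≢0 =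
        χ-cong (λ p∼w → R.trans p∼w (supported w x Swx≢0)) (λ p∼x → R.trans p∼x (R.sym (supported w x Swx≢0)))
        where module R = IsEquivalence R-equiv

      degrees-agree : ∀ {R} → IsEquivalence (λ p q → T (R p q)) → Supported R → ∀ r →
        AgreeOnSupport S (λ u → degreeInto R (inj₁ u) r) (λ x → degreeInto R (inj₂ x) r)
      degrees-agree {R} R-equiv supported r = ≡S⊙⇒agreeOnSupport S-ds
        (⊙-intertwined (adjMatrix-sym G) (adjMatrix-sym H) AS≡SB (agreeOnSupport⇒≡S⊙ S-ds members-agree))
        (⊙ᵗ-intertwined (adjMatrix-sym G) (adjMatrix-sym H) AS≡SB (agreeOnSupport⇒≡Sᵗ⊙ S-ds members-agree))
        where
        members-agree : AgreeOnSupport S (λ w → χ (R (inj₁ w) r)) (λ y → χ (R (inj₂ y) r))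
        members-agree w y Swy≢0 =
          trans (χ-sym (inj₁ w)) (trans (membership-agrees R-equiv supported r w y Swy≢0) (sym (χ-sym (inj₂ y))))
          where
          χ-sym : ∀ p → χ (R p r) ≡ χ (R r p)
          χ-sym p = χ-cong (IsEquivalence.sym R-equiv) (IsEquivalence.sym R-equiv)

      refinement-supported : ∀ k → Supported (refinement k)
      refinement-supported zero    u x _     = _
      refinement-supported (suc k) u x Sux≢0 =
        ⇒refine (refinement k) (inj₁ u) (inj₂ x) (refinement-supported k u x Sux≢0) (λ r →
          degrees-agree (refinement-isEquivalence k) (refinement-supported k) r u x Sux≢0)

      stable : ∃ λ K → ∀ (pq : Vertex × Vertex) → uncurry (refinement (suc K)) pq ≡ uncurry (refinement K) pq
      stable = decreasing-stabilises ((+↔⊎ ×-↔ +↔⊎) ↔-∘ *↔×) (uncurry ∘ refinement)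
        (λ k (p , q) → proj₁ ∘ refine⇒ (refinement k) p q)

      K = proj₁ stable

    stablePartition : CommonEquitablePartition
    stablePartition = record
      { _∼_           = refinement K
      ; isEquivalence = refinement-isEquivalence K
      ; equitable     = λ {p} {q} p∼q →
          proj₂ (refine⇒ (refinement K) p q (subst T (sym (proj₂ stable (p , q))) p∼q))
      ; sizes-agree   = λ p → agreeOnSupport⇒sumF≡ S-ds
          (membership-agrees (refinement-isEquivalence K) (refinement-supported K) p)
      }

-- let, not with: abstracting over the stable partition makes Agda evaluate the colour refinement.
mainTheorem1 : (G H : Graph) → FracIso G H → IncEquiv G H
mainTheorem1 G H (S , S-ds , AS≡SB) =
  let (X , X-ds , AX≡XB , X-balanced) = commonEquitablePartition⇒balanced G H (stablePartition G H S-ds AS≡SB)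
  in balanced⇒incEquiv G H X-ds AX≡XB X-balanced
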